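{- Let $\mathcal{D}$ be a concrete domain. If $\mathcal{D}$ satisfies the completion property, then $\mathcal{D}$ satisfies the amalgamation property.
   Context: A concrete domain is a relational structure $\mathcal{D}=(\mathbb{D},P_1^{\mathbb{D}},P_2^{\mathbb{D}},\dots)$ with $\mathbb{D}$ a nonempty set and each $P_i^{\mathbb{D}}\subseteq \mathbb{D}^{k_i}$ interpreting a predicate symbol $P_i$ of arity $k_i$; let $\mathcal{P}_{\mathcal{D}}$ be its set of predicate symbols (finite or infinite). Fix a countably infinite set $\mathrm{VAR}$ of variables. A constraint system $S$ is a set of literals of the form $P(v_1,\dots,v_k)$ or $\neg P(v_1,\dots,v_k)$ with $P$ a predicate symbol of arity $k$ and $v_i\in\mathrm{VAR}$ (repetitions allowed); $\mathrm{VAR}(S)$ denotes the variables occurring in $S$, and for $X\subseteq\mathrm{VAR}$, $S|_X$ is the set of literals of $S$ using only variables from $X$. A valuation $v$ (on $\mathrm{VAR}$ or a subset) satisfies $P(v_1,\dots,v_k)$ iff $(v(v_1),\dots,v(v_k))\in P^{\mathbb{D}}$, satisfies $\neg P(\dots)$ iff it does not satisfy $P(\dots)$, and satisfies $S$ iff it satisfies every literal of $S$; $S$ is satisfiable if some valuation satisfies it. Completion property: for every finite constraint system $S$ and every valuation $v:X\to\mathbb{D}$ with $X\subseteq \mathrm{VAR}(S)$, if $v$ satisfies $S|_X$ and $S$ is satisfiable, then there is $v':\mathrm{VAR}(S)\to\mathbb{D}$ with $v'|_X=v$ and $v'$ satisfying $S$. A constraint system $S$ is complete w.r.t. a set $\mathcal{P}$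 of predicate symbols and a set $X$ of variables iff only predicate symbols from $\mathcal{P}$ and variables from $X$ occur in $S$, and for every $P\in\mathcal{P}$ of arity $k$ and all $v_1,\dots,v_k\in X$, exactly one of $P(v_1,\dots,v_k)$, $\neg P(v_1,\dots,v_k)$ belongs to $S$. Amalgamation property: (i) if $\mathcal{P}_{\mathcal{D}}$ is finite: for all finite constraint systems $S,S'$ such that, writing $V_0=\mathrm{VAR}(S)\cap\mathrm{VAR}(S')$, we have $S|_{V_0}=S'|_{V_0}$ and $S|_{V_0}$ is complete w.r.t. $\mathcal{P}_{\mathcal{D}}$ and $V_0$, it holds that ($S$ and $S'$ are each satisfiable) iff $S\cup S'$ is satisfiable; (ii) if $\mathcal{P}_{\mathcal{D}}$ is infinite: the same holds for every finite $\mathcal{P}\subseteq\mathcal{P}_{\mathcal{D}}$ and all finite constraint systems $S,S'$ built over $\mathcal{P}$ with $S|_{V_0}=S'|_{V_0}$ and $S|_{V_0}$ complete w.r.t. $\mathcal{P}$ and $V_0$. -}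

module Defs where

open import Data.Nat using (ℕ)
open import Data.Bool using (Bool; true; false)
open import Data.Unit using (⊤)
open import Data.Product using (Σ; ∃; _×_; _,_)
open import Data.Sum using (_⊎_)
open import Data.List using (List; _++_)
open import Data.List.Membership.Propositional using (_∈_)
open import Data.Vec using (Vec; map)
import Data.Vec.Membership.Propositional as VecMem
open import Data.Vec.Relation.Unary.All using (All)
open import Relation.Nullary using (¬_)
open import Relation.Binary.PropositionalEquality using (_≡_)
open import Function.Bundles using (_⇔_)

record ConcreteDomain : Set₁ where
  field
    𝔻          : Set
    inhabitant : 𝔻
    PredSym    : Set
    arity      : PredSym → ℕ
    ⟦_⟧        : (P : PredSym) → Vec 𝔻 (arity P) → Set

VAR : Set
VAR = ℕ

Finite : Set → Set
Finite A = Σ (List A) (λ xs → ∀ a → a ∈ xs)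

module _ (𝒟 : ConcreteDomain) where
  open ConcreteDomain 𝒟

  record Literal : Set where
    constructor lit
    field
      positive : Bool
      sym      : PredSym
      args     : Vec VAR (arity sym)
  open Literal public

  -- finite constraint systems, represented as lists of literals
  -- (only membership matters, i.e. they are read as finite sets)
  ConstraintSystem : Set
  ConstraintSystem = List Literal

  Valuation : Set
  Valuation = VAR → 𝔻

  _⊨ₗ_ : Valuation → Literal → Set
  v ⊨ₗ lit true  P xs = ⟦ P ⟧ (map v xs)
  v ⊨ₗ lit false P xs = ¬ ⟦ P ⟧ (map v xs)

  _⊨_ : Valuation → ConstraintSystem → Set
  v ⊨ S = ∀ l → l ∈ S → v ⊨ₗ l

  Satisfiable : ConstraintSystem → Set
  Satisfiable S = ∃ λ (v : Valuation) → v ⊨ S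

  _∈VAR_ : VAR → ConstraintSystem → Set
  x ∈VAR S = ∃ λ l → l ∈ S × VecMem._∈_ x (args l)

  UsesOnly : (VAR → Set) → Literal → Set
  UsesOnly X l = All X (args l)

  _∈_∣_ : Literal → ConstraintSystem → (VAR → Set) → Set
  l ∈ S ∣ X = l ∈ S × UsesOnly X l

  _⊨_∣_ : Valuation → ConstraintSystem → (VAR → Set) → Set
  v ⊨ S ∣ X = ∀ l → l ∈ S ∣ X → v ⊨ₗ l

  Shared : ConstraintSystem → ConstraintSystem → VAR → Set
  Shared S S' x = x ∈VAR S × x ∈VAR S'

  RestrEq : ConstraintSystem → ConstraintSystem → (VAR → Set) → Set
  RestrEq S S' X = ∀ l → (l ∈ S ∣ X) ⇔ (l ∈ S' ∣ X)

  CompleteWrt : (Literal → Set) → (PredSym → Set) → (VAR → Set) → Set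
  CompleteWrt M 𝒫 X =
    (∀ l → M l → 𝒫 (sym l) × UsesOnly X l)
    × (∀ P → 𝒫 P → (xs : Vec VAR (arity P)) → All X xs →
         (M (lit true P xs) × ¬ M (lit false P xs))
         ⊎ (M (lit false P xs) × ¬ M (lit true P xs)))

  BuiltOver : List PredSym → ConstraintSystem → Set
  BuiltOver 𝒫 S = ∀ l → l ∈ S → sym l ∈ 𝒫

  CompletionProperty : Set₁
  CompletionProperty =
    (S : ConstraintSystem) (X : VAR → Set) →
    (∀ x → X x → x ∈VAR S) →
    (v : Valuation) → v ⊨ S ∣ X → Satisfiable S →
    ∃ λ (v' : Valuation) → (∀ x → X x → v' x ≡ v x) × v' ⊨ S

  AmalgamationFinite : Set
  AmalgamationFinite =
    (S S' : ConstraintSystem) →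
    RestrEq S S' (Shared S S') →
    CompleteWrt (λ l → l ∈ S ∣ Shared S S') (λ _ → ⊤) (Shared S S') →
    (Satisfiable S × Satisfiable S') ⇔ Satisfiable (S ++ S')

  AmalgamationInfinite : Set
  AmalgamationInfinite =
    (𝒫 : List PredSym) (S S' : ConstraintSystem) →
    BuiltOver 𝒫 S → BuiltOver 𝒫 S' →
    RestrEq S S' (Shared S S') →
    CompleteWrt (λ l → l ∈ S ∣ Shared S S') (_∈ 𝒫) (Shared S S') →
    (Satisfiable S × Satisfiable S') ⇔ Satisfiable (S ++ S')

  AmalgamationProperty : Set
  AmalgamationProperty =
    (Finite PredSym → AmalgamationFinite)
    × (¬ Finite PredSym → AmalgamationInfinite)

{-# OPTIONS --safe #-}
-- Given a model v of S, the literals of S' over the shared variables V₀ are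
-- literals of S, so v satisfies S'|V₀; as S' is satisfiable, the completion
-- property extends v|V₀ to a model w of S'. The valuation that follows v on
-- VAR(S) and w elsewhere satisfies S ∪ S', since v and w agree on V₀.
module Submission where

open import Defs
open import Data.Bool using (true; false)
open import Data.Empty using (⊥-elim)
open import Data.Nat using (_≟_)
open import Data.Product using (_×_; _,_; proj₁; proj₂)
open import Data.Sum using (inj₁; inj₂)
open import Data.List using (_++_)
open import Data.List.Membership.Propositional using (_∈_; find; lose)
open import Data.List.Membership.Propositional.Properties using (∈-++⁺ˡ; ∈-++⁺ʳ; ∈-++⁻)
open import Data.List.Relation.Unary.Any using (any?)
open import Data.Vec using (Vec; map; []; _∷_)
open import Data.Vec.Relation.Unary.Any using (here; there)
open import Data.Vec.Membership.Propositional using () renaming (_∈_ to _∈ᵥ_)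
open import Data.Vec.Membership.DecPropositional _≟_ using (_∈?_)
open import Relation.Nullary using (Dec; yes; no)
open import Relation.Nullary.Decidable using (map′)
open import Relation.Binary.PropositionalEquality as ≡ using (_≡_; refl; cong₂; subst)
open import Function using (_∘_)
open import Function.Bundles using (_⇔_; mk⇔; Equivalence)

map-cong-∈ : ∀ {A B : Set} {k} {f g : A → B} (xs : Vec A k) →
             (∀ {x} → x ∈ᵥ xs → f x ≡ g x) → map f xs ≡ map g xs
map-cong-∈ []       f≡g = refl
map-cong-∈ (x ∷ xs) f≡g = cong₂ _∷_ (f≡g (here refl)) (map-cong-∈ xs (f≡g ∘ there))

module _ (𝒟 : ConcreteDomain) where
  open ConcreteDomain 𝒟

  _∈VAR?_ : (x : VAR) (S : ConstraintSystem 𝒟) → Dec (_∈VAR_ 𝒟 x S)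
  x ∈VAR? S = map′ find (λ (_ , l∈S , x∈l) → lose l∈S x∈l)
                       (any? (λ l → x ∈? args l) S)

  ⊨ₗ-cong : (l : Literal 𝒟) {u w : Valuation 𝒟} →
            (∀ {x} → x ∈ᵥ args l → u x ≡ w x) →
            _⊨ₗ_ 𝒟 u l → _⊨ₗ_ 𝒟 w l
  ⊨ₗ-cong (lit true  P xs) u≡w u⊨l = subst ⟦ P ⟧ (map-cong-∈ xs u≡w) u⊨l
  ⊨ₗ-cong (lit false P xs) u≡w u⊨l = u⊨l ∘ subst ⟦ P ⟧ (≡.sym (map-cong-∈ xs u≡w))

  ⊨-cong : (S : ConstraintSystem 𝒟) {u w : Valuation 𝒟} →
           (∀ {x} → _∈VAR_ 𝒟 x S → u x ≡ w x) →
           _⊨_ 𝒟 u S → _⊨_ 𝒟 w S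
  ⊨-cong S u≡w u⊨S l l∈S = ⊨ₗ-cong l (λ x∈l → u≡w (l , l∈S , x∈l)) (u⊨S l l∈S)

  ⊨-++⁺ : ∀ {v} (S S' : ConstraintSystem 𝒟) →
          _⊨_ 𝒟 v S → _⊨_ 𝒟 v S' → _⊨_ 𝒟 v (S ++ S')
  ⊨-++⁺ S S' v⊨S v⊨S' l l∈S++S' with ∈-++⁻ S l∈S++S'
  ... | inj₁ l∈S  = v⊨S l l∈S
  ... | inj₂ l∈S' = v⊨S' l l∈S'

  ⊨-++⁻ : ∀ {v} (S S' : ConstraintSystem 𝒟) →
          _⊨_ 𝒟 v (S ++ S') → _⊨_ 𝒟 v S × _⊨_ 𝒟 v S'
  ⊨-++⁻ S S' v⊨S++S' = (λ l l∈S → v⊨S++S' l (∈-++⁺ˡ l∈S))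
                     , (λ l l∈S' → v⊨S++S' l (∈-++⁺ʳ S l∈S'))

  splice : ConstraintSystem 𝒟 → Valuation 𝒟 → Valuation 𝒟 → Valuation 𝒟
  splice S v w x with x ∈VAR? S
  ... | yes _ = v x
  ... | no  _ = w x

  splice-inside : ∀ S v w {x} → _∈VAR_ 𝒟 x S → splice S v w x ≡ v x
  splice-inside S v w {x} x∈S with x ∈VAR? S
  ... | yes _   = refl
  ... | no  x∉S = ⊥-elim (x∉S x∈S)

  splice-shared : ∀ S S' v w {x} → (∀ {y} → Shared 𝒟 S S' y → v y ≡ w y) →
                  _∈VAR_ 𝒟 x S' → splice S v w x ≡ w x
  splice-shared S S' v w {x} v≡w x∈S' with x ∈VAR? S
  ... | yes x∈S = v≡w (x∈S , x∈S')
  ... | no  _   = refl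

  splice-⊨-++ : ∀ S S' {v w} → (∀ {y} → Shared 𝒟 S S' y → v y ≡ w y) →
                _⊨_ 𝒟 v S → _⊨_ 𝒟 w S' → _⊨_ 𝒟 (splice S v w) (S ++ S')
  splice-⊨-++ S S' {v} {w} v≡w v⊨S w⊨S' = ⊨-++⁺ S S'
    (⊨-cong S  (λ x∈S  → ≡.sym (splice-inside S v w x∈S)) v⊨S)
    (⊨-cong S' (λ x∈S' → ≡.sym (splice-shared S S' v w v≡w x∈S')) w⊨S')

  completion⇒amalgamation :
    CompletionProperty 𝒟 → (S S' : ConstraintSystem 𝒟) →
    (∀ l → _∈_∣_ 𝒟 l S' (Shared 𝒟 S S') → _∈_∣_ 𝒟 l S (Shared 𝒟 S S')) →
    (Satisfiable 𝒟 S × Satisfiable 𝒟 S') ⇔ Satisfiable 𝒟 (S ++ S')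
  completion⇒amalgamation completion S S' S'∣V₀⊆S∣V₀ = mk⇔ amalgamate restrict
    where
    restrict : Satisfiable 𝒟 (S ++ S') → Satisfiable 𝒟 S × Satisfiable 𝒟 S'
    restrict (v , v⊨S++S') = let v⊨S , v⊨S' = ⊨-++⁻ S S' v⊨S++S' in (v , v⊨S) , (v , v⊨S')

    amalgamate : Satisfiable 𝒟 S × Satisfiable 𝒟 S' → Satisfiable 𝒟 (S ++ S')
    amalgamate ((v , v⊨S) , S'-sat) =
      let v⊨S'∣V₀ = λ l l∈S'∣V₀ → v⊨S l (proj₁ (S'∣V₀⊆S∣V₀ l l∈S'∣V₀))
          w , w≡v , w⊨S' = completion S' (Shared 𝒟 S S') (λ _ → proj₂) v v⊨S'∣V₀ S'-sat
      in splice S v w , splice-⊨-++ S S' (λ x∈V₀ → ≡.sym (w≡v _ x∈V₀)) v⊨S w⊨S'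

lemma1 : (𝒟 : ConcreteDomain) → CompletionProperty 𝒟 → AmalgamationProperty 𝒟
lemma1 𝒟 completion =
    (λ _ S S' S∣V₀≡S'∣V₀ _ → amalgamation S S' S∣V₀≡S'∣V₀)
  , (λ _ _ S S' _ _ S∣V₀≡S'∣V₀ _ → amalgamation S S' S∣V₀≡S'∣V₀)
  where
  amalgamation : ∀ S S' → RestrEq 𝒟 S S' (Shared 𝒟 S S') →
                 (Satisfiable 𝒟 S × Satisfiable 𝒟 S') ⇔ Satisfiable 𝒟 (S ++ S')
  amalgamation S S' S∣V₀≡S'∣V₀ =
    completion⇒amalgamation 𝒟 completion S S' (λ l → Equivalence.from (S∣V₀≡S'∣V₀ l))
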